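{- Let $\Sigma$ be a finite alphabet, $\mathbf{S} \in (\Sigma \cup \{*\})^{n \times \ell}$ and $d_1, \dots, d_n \in \mathbb{N}$, and let $d = \max_{i \in [n]} d_i$. If $\mathbf{S}$ contains more than $nd$ dirty columns, then there is no row vector $v \in \Sigma^\ell$ with $\delta(v, \mathbf{S}[i]) \le d_i$ for all $i \in [n]$.
   Context: The symbol $*$ denotes a missing entry and is not in $\Sigma$. $\mathbf{S}[i]$ denotes the $i$-th row. A column of $\mathbf{S}$ is dirty if it contains at least two distinct symbols from $\Sigma$. For $v, v' \in (\Sigma \cup \{*\})^\ell$, $\delta(v,v')$ is the number of positions $j$ with $v[j] \ne v'[j]$, $v[j]\ne *$ and $v'[j]\ne *$. $[n]=\{1,\dots,n\}$. -}

module Defs where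

open import Data.Nat using (ℕ; zero; suc; _+_; _⊔_)
open import Data.Fin using (Fin; zero; suc)
import Data.Fin.Properties as FinP
open import Data.Maybe using (Maybe; just; nothing)
open import Data.Product using (∃; _×_)
open import Relation.Binary.PropositionalEquality using (_≡_; _≢_)
open import Relation.Nullary using (yes; no)

-- Alphabet Σ = Fin k (a finite alphabet); the symbol * is `nothing`.
Entry : ℕ → Set
Entry k = Maybe (Fin k)

Matrix : ℕ → ℕ → ℕ → Set
Matrix k n ℓ = Fin n → Fin ℓ → Entry k

countFin : ∀ {ℓ} → (Fin ℓ → ℕ) → ℕ
countFin {zero}  f = 0
countFin {suc ℓ} f = f zero + countFin (λ j → f (suc j))

mismatch : ∀ {k} → Entry k → Entry k → ℕ
mismatch (just a) (just b) with a FinP.≟ b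
... | yes _ = 0
... | no  _ = 1
mismatch _ _ = 0

δ : ∀ {k ℓ} → (Fin ℓ → Entry k) → (Fin ℓ → Entry k) → ℕ
δ v v' = countFin (λ j → mismatch (v j) (v' j))

maxFin : ∀ {n} → (Fin n → ℕ) → ℕ
maxFin {zero}  d = 0
maxFin {suc n} d = d zero ⊔ maxFin (λ i → d (suc i))

Dirty : ∀ {k n ℓ} → Matrix k n ℓ → Fin ℓ → Set
Dirty {k} {n} S j =
  ∃ λ (i : Fin n) → ∃ λ (i' : Fin n) → ∃ λ (a : Fin k) → ∃ λ (b : Fin k) →
    S i j ≡ just a × S i' j ≡ just b × a ≢ b

embed : ∀ {k ℓ} → (Fin ℓ → Fin k) → Fin ℓ → Entry k
embed v j = just (v j)

-- Let v witness the contrary. In a dirty column j the symbol v[j] differs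
-- from the symbol of some row, so every dirty column contributes at least
-- one mismatch to the total ∑ᵢ δ(v, S[i]). Hence that total is at least the
-- number of dirty columns, while the row constraints bound it by
-- ∑ᵢ dᵢ ≤ n·d.
module Submission where

open import Defs
open import Data.Nat using (ℕ; _*_; _<_; _≤_; zero; suc; _+_; z≤n)
open import Data.Nat.Properties
  using (+-0-commutativeMonoid; +-mono-≤; +-monoʳ-≤; m≤m+n; m≤m⊔n; m≤n⊔m;
         ≤-trans; ≤-reflexive; <⇒≱; *-identityʳ; module ≤-Reasoning)
open import Data.Fin using (Fin; zero; suc; punchIn; punchOut)
open import Data.Fin.Properties using (_≟_; suc-injective; punchIn-punchOut; punchOut-injective)
open import Data.Maybe using (just)
open import Data.Product using (Σ; ∃-syntax; _×_; _,_)
open import Data.Empty using (⊥-elim)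
open import Function.Base using (_∘_)
open import Function.Definitions using (Injective)
open import Relation.Binary.PropositionalEquality
  using (_≡_; _≢_; refl; sym; trans; cong)
open import Relation.Nullary using (¬_; yes; no)
open import Algebra.Properties.CommutativeMonoid.Sum +-0-commutativeMonoid
  using (sum; sum-remove; ∑-comm; sum-cong-≗)

countFin≡sum : ∀ {ℓ} (f : Fin ℓ → ℕ) → countFin f ≡ sum f
countFin≡sum {zero}  f = refl
countFin≡sum {suc ℓ} f = cong (f zero +_) (countFin≡sum (f ∘ suc))

sum-const : ∀ n c → sum {n} (λ _ → c) ≡ n * c
sum-const zero    c = refl
sum-const (suc n) c = cong (c +_) (sum-const n c)

sum-mono-≤ : ∀ {n} {f g : Fin n → ℕ} → (∀ i → f i ≤ g i) → sum f ≤ sum g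
sum-mono-≤ {zero}  f≤g = z≤n
sum-mono-≤ {suc n} f≤g = +-mono-≤ (f≤g zero) (sum-mono-≤ (f≤g ∘ suc))

term≤sum : ∀ {n} (f : Fin n → ℕ) i → f i ≤ sum f
term≤sum {suc n} f i = ≤-trans (m≤m+n (f i) _) (≤-reflexive (sym (sum-remove {i = i} f)))

-- After removing the term at g zero, the remaining indices g (suc t) are
-- re-indexed into the smaller index set by punchOut, which stays injective.
sum-injective-≤ : ∀ {m ℓ} (g : Fin m → Fin ℓ) → Injective _≡_ _≡_ g →
                  (f : Fin ℓ → ℕ) → sum (f ∘ g) ≤ sum f
sum-injective-≤ {zero}          g g-inj f = z≤n
sum-injective-≤ {suc m} {zero}  g g-inj f with g zero
... | ()
sum-injective-≤ {suc m} {suc ℓ} g g-inj f = begin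
    f (g zero) + sum (f ∘ g ∘ suc)
  ≡⟨ cong (f (g zero) +_) (sum-cong-≗ (λ t → cong f (sym (punchIn-punchOut (g₀≢g t))))) ⟩
    f (g zero) + sum (f∖g₀ ∘ g′)
  ≤⟨ +-monoʳ-≤ (f (g zero)) (sum-injective-≤ g′ g′-inj f∖g₀) ⟩
    f (g zero) + sum f∖g₀
  ≡⟨ sym (sum-remove {i = g zero} f) ⟩
    sum f ∎
  where
  open ≤-Reasoning
  f∖g₀ : Fin ℓ → ℕ
  f∖g₀ = f ∘ punchIn (g zero)
  g₀≢g : ∀ t → g zero ≢ g (suc t)
  g₀≢g t eq with g-inj eq
  ... | ()
  g′ : Fin m → Fin ℓ
  g′ t = punchOut (g₀≢g t)
  g′-inj : Injective _≡_ _≡_ g′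
  g′-inj {s} {t} eq = suc-injective
    (g-inj (punchOut-injective (g₀≢g s) (g₀≢g t) eq))

≤-maxFin : ∀ {n} (d : Fin n → ℕ) i → d i ≤ maxFin d
≤-maxFin d zero    = m≤m⊔n _ _
≤-maxFin d (suc i) = ≤-trans (≤-maxFin (d ∘ suc) i) (m≤n⊔m _ _)

mismatch-≢ : ∀ {k} {a b : Fin k} → a ≢ b → mismatch (just a) (just b) ≡ 1
mismatch-≢ {a = a} {b} a≢b with a ≟ b
... | yes a≡b = ⊥-elim (a≢b a≡b)
... | no  _   = refl

Dirty⇒symbol-≢ : ∀ {k n ℓ} (S : Matrix k n ℓ) j → Dirty S j →
                 ∀ x → ∃[ i ] ∃[ a ] S i j ≡ just a × x ≢ a
Dirty⇒symbol-≢ S j (i , i′ , a , b , Sij≡a , Si′j≡b , a≢b) x with x ≟ a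
... | yes refl = i′ , b , Si′j≡b , a≢b
... | no  x≢a  = i  , a , Sij≡a  , x≢a

Dirty⇒mismatch : ∀ {k n ℓ} (S : Matrix k n ℓ) j → Dirty S j →
                 ∀ x → 1 ≤ sum (λ i → mismatch (just x) (S i j))
Dirty⇒mismatch S j dirty x with Dirty⇒symbol-≢ S j dirty x
... | i , a , Sij≡a , x≢a = ≤-trans
  (≤-reflexive (sym (trans (cong (mismatch (just x)) Sij≡a) (mismatch-≢ x≢a))))
  (term≤sum (λ i → mismatch (just x) (S i j)) i)

lemma8 : (k n ℓ : ℕ) (S : Matrix k n ℓ) (ds : Fin n → ℕ) →
    (m : ℕ) (cols : Fin m → Fin ℓ) → Injective _≡_ _≡_ cols →
    (∀ t → Dirty S (cols t)) → n * maxFin ds < m →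
    ¬ (Σ (Fin ℓ → Fin k) λ v → ∀ i → δ (embed v) (S i) ≤ ds i)
lemma8 k n ℓ S ds m cols cols-inj dirty n*d<m (v , close) = <⇒≱ n*d<m (begin
    m                                     ≡⟨ sym (trans (sum-const m 1) (*-identityʳ m)) ⟩
    sum {m} (λ _ → 1)                     ≤⟨ sum-mono-≤ (λ t → Dirty⇒mismatch S (cols t) (dirty t) (v (cols t))) ⟩
    sum (mismatchesIn ∘ cols)             ≤⟨ sum-injective-≤ cols cols-inj mismatchesIn ⟩
    sum mismatchesIn                      ≡⟨ sym (∑-comm mismatch-at) ⟩
    sum (λ i → sum (mismatch-at i))       ≡⟨ sum-cong-≗ (λ i → sym (countFin≡sum (mismatch-at i))) ⟩
    sum (λ i → δ (embed v) (S i))         ≤⟨ sum-mono-≤ (λ i → ≤-trans (close i) (≤-maxFin ds i)) ⟩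
    sum {n} (λ _ → maxFin ds)             ≡⟨ sum-const n (maxFin ds) ⟩
    n * maxFin ds                         ∎)
  where
  open ≤-Reasoning
  mismatch-at : Fin n → Fin ℓ → ℕ
  mismatch-at i j = mismatch (just (v j)) (S i j)
  mismatchesIn : Fin ℓ → ℕ
  mismatchesIn j = sum (λ i → mismatch-at i j)
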